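{- Let $a,b,c$ be complex numbers and, for integers $n\ge0$, $$\chi_n(a,b,c):=\sum_{k=0}^{n-1}q^k\frac{(abc;q^3)_k(b,c;q)_k}{(bc/q^2;q)_{2k+2}(aq;q)_k}.$$ Then for every integer $n\ge0$ (whenever no denominator vanishes) $$\chi_n(a,b,c)=\frac{(1-abc)(1-aq^3/b)(1-aq^3/c)}{(aq;q)_3}\chi_n(aq^3,b,c)+\frac{aq^3}{bc(aq;q)_2}\left\{1-\frac{(abc;q^3)_n(b,c;q)_n}{(bc/q^2;q)_{2n}(aq^3;q)_n}\right\}.$$
   Context: $q$ is a complex number with $|q|<1$. For a base $p$ and integer $k\ge0$, $(z;p)_k:=\prod_{j=0}^{k-1}(1-zp^j)$, and $(z_1,\dots,z_m;p)_k:=(z_1;p)_k\cdots(z_m;p)_k$. -}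

module Defs where

open import Level using (Level; _⊔_) renaming (suc to lsuc)
open import Data.Nat using (ℕ; zero; suc) renaming (_+_ to _+ℕ_; _*_ to _*ℕ_)
open import Relation.Nullary using (¬_)
open import Algebra.Bundles using (CommutativeRing)

-- A field: a commutative ring with 0 ≠ 1 and a (total) inverse operation
-- which is a genuine multiplicative inverse on every nonzero element.
-- (The value of x ⁻¹ at x ≈ 0 is unconstrained; it is never used below
-- because all denominators are assumed nonzero.)
record Field (c ℓ : Level) : Set (lsuc (c ⊔ ℓ)) where
  field
    commutativeRing : CommutativeRing c ℓ
  open CommutativeRing commutativeRing public
  field
    _⁻¹      : Carrier → Carrier
    inverseʳ : ∀ x → ¬ (x ≈ 0#) → x * (x ⁻¹) ≈ 1#
    0≉1      : ¬ (0# ≈ 1#)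

module FieldDefs {c ℓ : Level} (F : Field c ℓ) where
  open Field F

  infixl 7 _/_
  _/_ : Carrier → Carrier → Carrier
  x / y = x * (y ⁻¹)

  infixr 8 _^_
  _^_ : Carrier → ℕ → Carrier
  x ^ zero  = 1#
  x ^ suc k = x ^ k * x

  poch : Carrier → Carrier → ℕ → Carrier
  poch z p zero    = 1#
  poch z p (suc k) = poch z p k * (1# - z * p ^ k)

  sumBelow : ℕ → (ℕ → Carrier) → Carrier
  sumBelow zero    f = 0#
  sumBelow (suc n) f = sumBelow n f + f n

  χ : (q : Carrier) → ℕ → Carrier → Carrier → Carrier → Carrier
  χ q n a b c = sumBelow n λ k →
    q ^ k * ((poch (a * b * c) (q ^ 3) k * poch b q k * poch c q k)
             / (poch (b * c / q ^ 2) q (2 *ℕ k +ℕ 2) * poch (a * q) q k))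

-- Telescoping. Let U_k be the ratio inside the braces at n = k, and R, C the two coefficients.
-- The k-th summand t_k(a) of χ_n(a) satisfies t_k(a) + C U_{k+1} = R t_k(aq³) + C U_k, so
-- summing over k < n and using U_0 = 1 gives the theorem. Multiplied by the common denominator
-- (bc/q²;q)_{2k+2} (aq³;q)_{k+1} bc (aq;q)_2, each of the four terms becomes
-- (abc;q³)_k (b,c;q)_k times a polynomial in a, b, c, q and q^k; this only uses
-- (aq;q)_{k+2} = (aq;q)_2 (aq³;q)_k and (z;p)_{k+1} = (1 - z) (zp;p)_k, and what remains is a
-- polynomial identity.
module Submission where

open import Defs
open import Level using (Level)
open import Algebra.Bundles using (CommutativeRing)
open import Data.Nat using (ℕ; zero; suc; _<_) renaming (_+_ to _+ℕ_; _*_ to _*ℕ_)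
import Data.Nat.Properties as ℕₚ
open import Data.Integer as ℤ using (ℤ; +_; -[1+_])
import Data.Integer.Properties as ℤₚ
import Data.Sign as Sign
open import Data.Maybe using (Maybe; just; nothing)
open import Relation.Nullary using (¬_; yes; no)
open import Relation.Binary.PropositionalEquality as ≡ using (_≡_)

-- Algebra.Solver.Ring needs a coefficient ring mapping into the carrier; ℤ maps into every
-- commutative ring. The optimised _×_ sends 1 to 1# itself, so that con (+ 1) evaluates to 1#
-- and solver polynomials match terms such as q ^ 3 = 1# * q * q * q definitionally.
module IntegerCoefficientSolver {c ℓ : Level} (R : CommutativeRing c ℓ) where
  open CommutativeRing R
  open import Algebra.Properties.Ring ring
    using (-0#≈0#; -‿involutive; -‿+-comm; -‿distribˡ-*; -‿distribʳ-*)
  open import Algebra.Properties.Semiring.Mult.TCOptimised semiring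
    using (_×_; 1+×; ×-homo-+; ×1-homo-*)
  open import Algebra.Solver.Ring.AlmostCommutativeRing
    using (fromCommutativeRing; _-Raw-AlmostCommutative⟶_)
  open import Relation.Binary.Reasoning.Setoid setoid

  ⟦_⟧ℤ : ℤ → Carrier
  ⟦ + n ⟧ℤ      = n × 1#
  ⟦ -[1+ n ] ⟧ℤ = - (suc n × 1#)

  private
    x-0#≈x : ∀ x → x - 0# ≈ x
    x-0#≈x x = trans (+-congˡ -0#≈0#) (+-identityʳ x)

    [1+x]-[1+y]≈x-y : ∀ x y → (1# + x) - (1# + y) ≈ x - y
    [1+x]-[1+y]≈x-y x y = begin
      (1# + x) + - (1# + y)    ≈⟨ +-congˡ (sym (-‿+-comm 1# y)) ⟩
      (1# + x) + (- 1# + - y)  ≈⟨ +-congʳ (+-comm 1# x) ⟩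
      (x + 1#) + (- 1# + - y)  ≈⟨ +-assoc x 1# _ ⟩
      x + (1# + (- 1# + - y))  ≈⟨ +-congˡ (sym (+-assoc 1# (- 1#) (- y))) ⟩
      x + ((1# + - 1#) + - y)  ≈⟨ +-congˡ (+-congʳ (-‿inverseʳ 1#)) ⟩
      x + (0# + - y)           ≈⟨ +-congˡ (+-identityˡ (- y)) ⟩
      x - y                    ∎

    ⊖-homo : ∀ m n → ⟦ m ℤ.⊖ n ⟧ℤ ≈ m × 1# - n × 1#
    ⊖-homo zero    zero    = sym (x-0#≈x 0#)
    ⊖-homo zero    (suc n) = sym (+-identityˡ _)
    ⊖-homo (suc m) zero    = sym (x-0#≈x _)
    ⊖-homo (suc m) (suc n) rewrite ℤₚ.[1+m]⊖[1+n]≡m⊖n m n = begin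
      ⟦ m ℤ.⊖ n ⟧ℤ                   ≈⟨ ⊖-homo m n ⟩
      m × 1# - n × 1#                ≈⟨ [1+x]-[1+y]≈x-y _ _ ⟨
      (1# + m × 1#) - (1# + n × 1#)  ≈⟨ +-cong (1+× m 1#) (-‿cong (1+× n 1#)) ⟨
      suc m × 1# - suc n × 1#        ∎

    +-homo : ∀ i j → ⟦ i ℤ.+ j ⟧ℤ ≈ ⟦ i ⟧ℤ + ⟦ j ⟧ℤ
    +-homo (+ m)      (+ n)      = ×-homo-+ 1# m n
    +-homo (+ m)      -[1+ n ]   = ⊖-homo m (suc n)
    +-homo -[1+ m ]   (+ n)      = trans (⊖-homo n (suc m)) (+-comm _ _)
    +-homo -[1+ m ]   -[1+ n ]   = begin
      - (suc (suc (m +ℕ n)) × 1#)      ≡⟨ ≡.cong (λ k → - (suc k × 1#)) (ℕₚ.+-suc m n) ⟨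
      - ((suc m +ℕ suc n) × 1#)        ≈⟨ -‿cong (×-homo-+ 1# (suc m) (suc n)) ⟩
      - (suc m × 1# + suc n × 1#)      ≈⟨ -‿+-comm _ _ ⟨
      - (suc m × 1#) + - (suc n × 1#)  ∎

    -‿homo : ∀ i → ⟦ ℤ.- i ⟧ℤ ≈ - ⟦ i ⟧ℤ
    -‿homo (+ zero)  = sym -0#≈0#
    -‿homo (+ suc n) = refl
    -‿homo -[1+ n ]  = sym (-‿involutive _)

    +◃-homo : ∀ n → ⟦ Sign.+ ℤ.◃ n ⟧ℤ ≈ n × 1#
    +◃-homo zero    = refl
    +◃-homo (suc n) = refl

    -◃-homo : ∀ n → ⟦ Sign.- ℤ.◃ n ⟧ℤ ≈ - (n × 1#)
    -◃-homo zero    = sym -0#≈0#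
    -◃-homo (suc n) = refl

    *-homo : ∀ i j → ⟦ i ℤ.* j ⟧ℤ ≈ ⟦ i ⟧ℤ * ⟦ j ⟧ℤ
    *-homo (+ m) (+ n) = trans (+◃-homo (m *ℕ n)) (×1-homo-* m n)
    *-homo (+ m) -[1+ n ] = begin
      ⟦ Sign.- ℤ.◃ (m *ℕ suc n) ⟧ℤ  ≈⟨ -◃-homo (m *ℕ suc n) ⟩
      - ((m *ℕ suc n) × 1#)         ≈⟨ -‿cong (×1-homo-* m (suc n)) ⟩
      - (m × 1# * suc n × 1#)       ≈⟨ -‿distribʳ-* _ _ ⟩
      m × 1# * - (suc n × 1#)       ∎
    *-homo -[1+ m ] (+ n) = begin
      ⟦ Sign.- ℤ.◃ (suc m *ℕ n) ⟧ℤ  ≈⟨ -◃-homo (suc m *ℕ n) ⟩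
      - ((suc m *ℕ n) × 1#)         ≈⟨ -‿cong (×1-homo-* (suc m) n) ⟩
      - (suc m × 1# * n × 1#)       ≈⟨ -‿distribˡ-* _ _ ⟩
      - (suc m × 1#) * n × 1#       ∎
    *-homo -[1+ m ] -[1+ n ] = begin
      (suc m *ℕ suc n) × 1#               ≈⟨ ×1-homo-* (suc m) (suc n) ⟩
      suc m × 1# * suc n × 1#             ≈⟨ -‿involutive _ ⟨
      - - (suc m × 1# * suc n × 1#)       ≈⟨ -‿cong (-‿distribˡ-* _ _) ⟩
      - (- (suc m × 1#) * suc n × 1#)     ≈⟨ -‿distribʳ-* _ _ ⟩
      - (suc m × 1#) * - (suc n × 1#)     ∎

    homomorphism : ℤ.+-*-rawRing -Raw-AlmostCommutative⟶ fromCommutativeRing R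
    homomorphism = record
      { ⟦_⟧ = ⟦_⟧ℤ ; +-homo = +-homo ; *-homo = *-homo ; -‿homo = -‿homo
      ; 0-homo = refl ; 1-homo = refl }

    _≟⟦⟧_ : ∀ i j → Maybe (⟦ i ⟧ℤ ≈ ⟦ j ⟧ℤ)
    i ≟⟦⟧ j with i ℤ.≟ j
    ... | yes ≡.refl = just refl
    ... | no _       = nothing

  open import Algebra.Solver.Ring ℤ.+-*-rawRing (fromCommutativeRing R) homomorphism _≟⟦⟧_ public

module FieldLemmas {c ℓ : Level} (F : Field c ℓ) where
  open Field F
  open FieldDefs F
  open IntegerCoefficientSolver commutativeRing
  open import Relation.Binary.Reasoning.Setoid setoid

  𝟏 : ∀ {n} → Polynomial n
  𝟏 = con (+ 1)

  *-/-cancel : ∀ x {d} → ¬ (d ≈ 0#) → x * d / d ≈ x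
  *-/-cancel x {d} d≉0 = begin
    x * d * d ⁻¹    ≈⟨ *-assoc x d (d ⁻¹) ⟩
    x * (d * d ⁻¹)  ≈⟨ *-congˡ (inverseʳ d d≉0) ⟩
    x * 1#          ≈⟨ *-identityʳ x ⟩
    x               ∎

  /-*-cancel : ∀ x {d} → ¬ (d ≈ 0#) → x / d * d ≈ x
  /-*-cancel x {d} d≉0 = begin
    x * d ⁻¹ * d    ≈⟨ *-assoc x (d ⁻¹) d ⟩
    x * (d ⁻¹ * d)  ≈⟨ *-congˡ (*-comm (d ⁻¹) d) ⟩
    x * (d * d ⁻¹)  ≈⟨ *-assoc x d (d ⁻¹) ⟨
    x * d / d       ≈⟨ *-/-cancel x d≉0 ⟩
    x               ∎

  *-cancelʳ-nonzero : ∀ {d x y} → ¬ (d ≈ 0#) → x * d ≈ y * d → x ≈ y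
  *-cancelʳ-nonzero {d} {x} {y} d≉0 xd≈yd = begin
    x          ≈⟨ *-/-cancel x d≉0 ⟨
    x * d / d  ≈⟨ *-congʳ xd≈yd ⟩
    y * d / d  ≈⟨ *-/-cancel y d≉0 ⟩
    y          ∎

  nonzero-* : ∀ {x y} → ¬ (x ≈ 0#) → ¬ (y ≈ 0#) → ¬ (x * y ≈ 0#)
  nonzero-* x≉0 y≉0 xy≈0 = x≉0 (*-cancelʳ-nonzero y≉0 (trans xy≈0 (sym (zeroˡ _))))

  nonzero-*ˡ : ∀ {x y} → ¬ (x * y ≈ 0#) → ¬ (x ≈ 0#)
  nonzero-*ˡ {y = y} xy≉0 x≈0 = xy≉0 (trans (*-congʳ x≈0) (zeroˡ y))

  nonzero-*ʳ : ∀ {x y} → ¬ (x * y ≈ 0#) → ¬ (y ≈ 0#)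
  nonzero-*ʳ {x} xy≉0 y≈0 = xy≉0 (trans (*-congˡ y≈0) (zeroʳ x))

  nonzero-resp : ∀ {x y} → x ≈ y → ¬ (x ≈ 0#) → ¬ (y ≈ 0#)
  nonzero-resp x≈y x≉0 y≈0 = x≉0 (trans x≈y y≈0)

  1≉0 : ¬ (1# ≈ 0#)
  1≉0 1≈0 = 0≉1 (sym 1≈0)

  ^-nonzero : ∀ {x} → ¬ (x ≈ 0#) → ∀ n → ¬ (x ^ n ≈ 0#)
  ^-nonzero x≉0 zero    = 1≉0
  ^-nonzero x≉0 (suc n) = nonzero-* (^-nonzero x≉0 n) x≉0

  *-clear : ∀ {x d n y e m} → x * d ≈ n → y * e ≈ m → (x * y) * (d * e) ≈ n * m
  *-clear {x} {d} {_} {y} {e} xd≈n ye≈m = begin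
    (x * y) * (d * e)  ≈⟨ solve 4 (λ x y d e → (x :* y) :* (d :* e) := (x :* d) :* (y :* e)) refl x y d e ⟩
    (x * d) * (y * e)  ≈⟨ *-cong xd≈n ye≈m ⟩
    _                  ∎

  1-/-clear : ∀ x {d} → ¬ (d ≈ 0#) → (1# - x / d) * d ≈ d - x
  1-/-clear x {d} d≉0 = begin
    (1# - x / d) * d  ≈⟨ solve 2 (λ y d → (𝟏 :- y) :* d := d :- y :* d) refl (x / d) d ⟩
    d - x / d * d     ≈⟨ +-congˡ (-‿cong (/-*-cancel x d≉0)) ⟩
    d - x             ∎

  ^-+ : ∀ x m n → x ^ (m +ℕ n) ≈ x ^ m * x ^ n
  ^-+ x zero    n = sym (*-identityˡ _)
  ^-+ x (suc m) n = begin
    x ^ (m +ℕ n) * x   ≈⟨ *-congʳ (^-+ x m n) ⟩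
    x ^ m * x ^ n * x  ≈⟨ solve 3 (λ a b x → a :* b :* x := a :* x :* b) refl (x ^ m) (x ^ n) x ⟩
    x ^ m * x * x ^ n  ∎

  ^-* : ∀ x m n → x ^ (m *ℕ n) ≈ (x ^ n) ^ m
  ^-* x zero    n = refl
  ^-* x (suc m) n = begin
    x ^ (n +ℕ m *ℕ n)     ≈⟨ ^-+ x n (m *ℕ n) ⟩
    x ^ n * x ^ (m *ℕ n)  ≈⟨ *-congˡ (^-* x m n) ⟩
    x ^ n * (x ^ n) ^ m   ≈⟨ *-comm _ _ ⟩
    (x ^ n) ^ m * x ^ n   ∎

  poch-cong : ∀ {z z′} p k → z ≈ z′ → poch z p k ≈ poch z′ p k
  poch-cong p zero    z≈z′ = refl
  poch-cong p (suc k) z≈z′ = *-cong (poch-cong p k z≈z′) (+-congˡ (-‿cong (*-congʳ z≈z′)))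

  poch-+ : ∀ z p m k → poch z p (m +ℕ k) ≈ poch z p m * poch (z * p ^ m) p k
  poch-+ z p m zero = begin
    poch z p (m +ℕ 0)  ≡⟨ ≡.cong (poch z p) (ℕₚ.+-identityʳ m) ⟩
    poch z p m         ≈⟨ *-identityʳ _ ⟨
    poch z p m * 1#    ∎
  poch-+ z p m (suc k) = begin
    poch z p (m +ℕ suc k)
      ≡⟨ ≡.cong (poch z p) (ℕₚ.+-suc m k) ⟩
    poch z p (m +ℕ k) * (1# - z * p ^ (m +ℕ k))
      ≈⟨ *-cong (poch-+ z p m k) (+-congˡ (-‿cong (*-congˡ (^-+ p m k)))) ⟩
    poch z p m * poch (z * p ^ m) p k * (1# - z * (p ^ m * p ^ k))
      ≈⟨ solve 5 (λ A B z s t → A :* B :* (𝟏 :- z :* (s :* t)) := A :* (B :* (𝟏 :- z :* s :* t)))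
               refl (poch z p m) (poch (z * p ^ m) p k) z (p ^ m) (p ^ k) ⟩
    poch z p m * (poch (z * p ^ m) p k * (1# - z * p ^ m * p ^ k))
      ∎

  poch-shift : ∀ z p k → poch (z * p) p k * (1# - z) ≈ poch z p (suc k)
  poch-shift z p k = begin
    poch (z * p) p k * (1# - z)
      ≈⟨ *-cong (poch-cong p k (*-congˡ (*-identityˡ p))) (+-congˡ (-‿cong (*-identityʳ z))) ⟨
    poch (z * p ^ 1) p k * (1# - z * 1#)
      ≈⟨ trans (*-congʳ (*-identityˡ _)) (*-comm _ _) ⟨
    poch z p 1 * poch (z * p ^ 1) p k
      ≈⟨ poch-+ z p 1 k ⟨
    poch z p (suc k)
      ∎

  telescope : ∀ n r (f g d : ℕ → Carrier) → (∀ k → k < n → f k + d (suc k) ≈ r * g k + d k) →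
              sumBelow n f + d n ≈ r * sumBelow n g + d 0
  telescope zero    r f g d step = solve 2 (λ r d → con (+ 0) :+ d := r :* con (+ 0) :+ d) refl r (d 0)
  telescope (suc n) r f g d step = begin
    (sumBelow n f + f n) + d (suc n)
      ≈⟨ +-assoc _ _ _ ⟩
    sumBelow n f + (f n + d (suc n))
      ≈⟨ +-congˡ (step n (ℕₚ.n<1+n n)) ⟩
    sumBelow n f + (r * g n + d n)
      ≈⟨ solve 3 (λ S y z → S :+ (y :+ z) := (S :+ z) :+ y) refl (sumBelow n f) (r * g n) (d n) ⟩
    (sumBelow n f + d n) + r * g n
      ≈⟨ +-congʳ (telescope n r f g d (λ k k<n → step k (ℕₚ.m<n⇒m<1+n k<n))) ⟩
    (r * sumBelow n g + d 0) + r * g n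
      ≈⟨ solve 4 (λ r S t z → (r :* S :+ z) :+ r :* t := r :* (S :+ t) :+ z) refl r (sumBelow n g) (g n) (d 0) ⟩
    r * (sumBelow n g + g n) + d 0
      ∎

module Recurrence {r ℓ : Level} (F : Field r ℓ) (q a b c : Field.Carrier F) where
  open Field F
  open FieldDefs F
  open FieldLemmas F
  open IntegerCoefficientSolver commutativeRing
  open import Relation.Binary.Reasoning.Setoid setoid

  x : Carrier
  x = b * c / q ^ 2

  summand : Carrier → ℕ → Carrier
  summand a′ k = q ^ k * ((poch (a′ * b * c) (q ^ 3) k * poch b q k * poch c q k)
                          / (poch x q (2 *ℕ k +ℕ 2) * poch (a′ * q) q k))

  remainder : ℕ → Carrier
  remainder n = (poch (a * b * c) (q ^ 3) n * poch b q n * poch c q n)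
                / (poch x q (2 *ℕ n) * poch (a * q ^ 3) q n)

  shiftCoefficient : Carrier
  shiftCoefficient = (1# - a * b * c) * (1# - a * q ^ 3 / b) * (1# - a * q ^ 3 / c) / poch (a * q) q 3

  remainderCoefficient : Carrier
  remainderCoefficient = a * q ^ 3 / (b * c * poch (a * q) q 2)

  -- The step identity after clearing denominators and dividing by (abc;q³)_k (b,c;q)_k, with
  -- u standing for q^k; the factor q⁴ clears the q² in bc/q².
  step-polynomial-identity : ∀ u →
    (u * ((1# - a * q * u) * (1# - a * q * (u * q)) * (1# - a * q ^ 3 * u) * (b * c))
      + a * q ^ 3 * (1# - a * b * c * (u * u * u)) * (1# - b * u) * (1# - c * u)) * (q ^ 2 * q ^ 2)
    ≈ (b - a * q ^ 3) * (c - a * q ^ 3) * (1# - a * b * c * (u * u * u)) * u * (q ^ 2 * q ^ 2)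
      + a * q ^ 3 * (q ^ 2 - b * c * (u * u)) * (q ^ 2 - b * c * (u * u * q)) * (1# - a * q ^ 3 * u)
  step-polynomial-identity = solve 5 (λ a b c q u →
      let q² = 𝟏 :* q :* q ; aq³ = a :* (𝟏 :* q :* q :* q) in
      (u :* ((𝟏 :- a :* q :* u) :* (𝟏 :- a :* q :* (u :* q)) :* (𝟏 :- aq³ :* u) :* (b :* c))
        :+ aq³ :* (𝟏 :- a :* b :* c :* (u :* u :* u)) :* (𝟏 :- b :* u) :* (𝟏 :- c :* u)) :* (q² :* q²)
      := (b :- aq³) :* (c :- aq³) :* (𝟏 :- a :* b :* c :* (u :* u :* u)) :* u :* (q² :* q²)
        :+ aq³ :* (q² :- b :* c :* (u :* u)) :* (q² :- b :* c :* (u :* u :* q)) :* (𝟏 :- aq³ :* u))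
    refl a b c q

  module Step (q≉0 : ¬ (q ≈ 0#)) (b≉0 : ¬ (b ≈ 0#)) (c≉0 : ¬ (c ≈ 0#))
              (Q₂≉0 : ¬ (poch (a * q) q 2 ≈ 0#)) (Q₃≉0 : ¬ (poch (a * q) q 3 ≈ 0#))
              (k : ℕ) (D₂≉0′ : ¬ (poch x q (2 *ℕ k +ℕ 2) ≈ 0#))
              (A₁≉0 : ¬ (poch (a * q) q k ≈ 0#)) (A₄≉0 : ¬ (poch (a * q ^ 3 * q) q k ≈ 0#)) where

    u D D₂ e₁ e₂ A₁ A₃ A₄ f P P′ Pf B C Q₂ Q₃ N Δ : Carrier
    u  = q ^ k
    D  = poch x q (2 *ℕ k)
    e₁ = 1# - x * q ^ (2 *ℕ k)
    e₂ = 1# - x * q ^ suc (2 *ℕ k)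
    D₂ = poch x q (suc (suc (2 *ℕ k)))
    A₁ = poch (a * q) q k
    A₃ = poch (a * q ^ 3) q k
    A₄ = poch (a * q ^ 3 * q) q k
    f  = 1# - a * q ^ 3 * u
    P  = poch (a * b * c) (q ^ 3) k
    P′ = poch (a * q ^ 3 * b * c) (q ^ 3) k
    Pf = 1# - a * b * c * (q ^ 3) ^ k
    B  = poch b q k
    C  = poch c q k
    Q₂ = poch (a * q) q 2
    Q₃ = poch (a * q) q 3
    N  = P * B * C
    Δ  = D₂ * (A₃ * f) * (b * c * Q₂)

    D₂-index : poch x q (2 *ℕ k +ℕ 2) ≡ D₂
    D₂-index = ≡.cong (poch x q) (ℕₚ.+-comm (2 *ℕ k) 2)

    D₂-index′ : poch x q (2 *ℕ suc k) ≡ D₂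
    D₂-index′ = ≡.cong (λ m → poch x q (suc m)) (ℕₚ.+-suc k (k +ℕ 0))

    A₁-A₃ : A₁ * (1# - a * q * u) * (1# - a * q * (u * q)) ≈ Q₂ * A₃
    A₁-A₃ = trans (poch-+ (a * q) q 2 k) (*-congˡ (poch-cong q k
      (solve 2 (λ a q → a :* q :* (𝟏 :* q :* q) := a :* (𝟏 :* q :* q :* q)) refl a q)))

    A₄-A₃ : A₄ * (1# - a * q ^ 3) ≈ A₃ * f
    A₄-A₃ = poch-shift (a * q ^ 3) q k

    P′-P : P′ * (1# - a * b * c) ≈ P * Pf
    P′-P = trans (*-congʳ (poch-cong (q ^ 3) k
      (solve 4 (λ a b c t → a :* t :* b :* c := a :* b :* c :* t) refl a b c (q ^ 3))))
      (poch-shift (a * b * c) (q ^ 3) k)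

    Q₂-Q₃ : Q₂ * (1# - a * q ^ 3) ≈ Q₃
    Q₂-Q₃ = solve 3 (λ Q a q → Q :* (𝟏 :- a :* (𝟏 :* q :* q :* q)) := Q :* (𝟏 :- a :* q :* (𝟏 :* q :* q)))
              refl Q₂ a q

    q^2k : q ^ (2 *ℕ k) ≈ u * u
    q^2k = trans (^-* q 2 k) (*-congʳ (*-identityˡ u))

    Pf-cube : Pf ≈ 1# - a * b * c * (u * u * u)
    Pf-cube = +-congˡ (-‿cong (*-congˡ (begin
      (q ^ 3) ^ k     ≈⟨ ^-* q k 3 ⟨
      q ^ (k *ℕ 3)    ≡⟨ ≡.cong (q ^_) (ℕₚ.*-comm k 3) ⟩
      q ^ (3 *ℕ k)    ≈⟨ ^-* q 3 k ⟩
      1# * u * u * u  ≈⟨ *-congʳ (*-congʳ (*-identityˡ u)) ⟩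
      u * u * u       ∎)))

    q²-clears-x : ∀ w → q ^ 2 * (1# - x * w) ≈ q ^ 2 - b * c * w
    q²-clears-x w = begin
      q ^ 2 * (1# - x * w)   ≈⟨ solve 3 (λ s x w → s :* (𝟏 :- x :* w) := s :- x :* s :* w) refl (q ^ 2) x w ⟩
      q ^ 2 - x * q ^ 2 * w  ≈⟨ +-congˡ (-‿cong (*-congʳ (/-*-cancel (b * c) (^-nonzero q≉0 2)))) ⟩
      q ^ 2 - b * c * w      ∎

    q²e₁ : q ^ 2 * e₁ ≈ q ^ 2 - b * c * (u * u)
    q²e₁ = trans (q²-clears-x _) (+-congˡ (-‿cong (*-congˡ q^2k)))

    q²e₂ : q ^ 2 * e₂ ≈ q ^ 2 - b * c * (u * u * q)
    q²e₂ = trans (q²-clears-x _) (+-congˡ (-‿cong (*-congˡ (*-congʳ q^2k))))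

    D₂≉0 : ¬ (D₂ ≈ 0#)
    D₂≉0 = ≡.subst (λ d → ¬ (d ≈ 0#)) D₂-index D₂≉0′

    D≉0 : ¬ (D ≈ 0#)
    D≉0 = nonzero-*ˡ (nonzero-*ˡ D₂≉0)

    A₃f≉0 : ¬ (A₃ * f ≈ 0#)
    A₃f≉0 = nonzero-resp A₄-A₃ (nonzero-* A₄≉0 (nonzero-*ʳ (nonzero-resp (sym Q₂-Q₃) Q₃≉0)))

    bcQ₂≉0 : ¬ (b * c * Q₂ ≈ 0#)
    bcQ₂≉0 = nonzero-* (nonzero-* b≉0 c≉0) Q₂≉0

    Δ≉0 : ¬ (Δ ≈ 0#)
    Δ≉0 = nonzero-* (nonzero-* D₂≉0 A₃f≉0) bcQ₂≉0

    summand-cleared : ∀ a′ → ¬ (D₂ * poch (a′ * q) q k ≈ 0#) →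
      summand a′ k * (D₂ * poch (a′ * q) q k) ≈ poch (a′ * b * c) (q ^ 3) k * B * C * u
    summand-cleared a′ d≉0 = begin
      summand a′ k * d  ≡⟨ ≡.cong (λ t → u * (M / (t * poch (a′ * q) q k)) * d) D₂-index ⟩
      u * (M / d) * d   ≈⟨ *-assoc u (M / d) d ⟩
      u * (M / d * d)   ≈⟨ *-congˡ (/-*-cancel M d≉0) ⟩
      u * M             ≈⟨ *-comm u M ⟩
      M * u             ∎
      where
      M d : Carrier
      M = poch (a′ * b * c) (q ^ 3) k * B * C
      d = D₂ * poch (a′ * q) q k

    remainderCoefficient-cleared : remainderCoefficient * (b * c * Q₂) ≈ a * q ^ 3
    remainderCoefficient-cleared = /-*-cancel (a * q ^ 3) bcQ₂≉0

    shiftCoefficient-cleared :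
      shiftCoefficient * (Q₃ * (b * c)) ≈ (1# - a * b * c) * (b - a * q ^ 3) * (c - a * q ^ 3)
    shiftCoefficient-cleared = begin
      shiftCoefficient * (Q₃ * (b * c))
        ≈⟨ *-assoc shiftCoefficient Q₃ (b * c) ⟨
      shiftCoefficient * Q₃ * (b * c)
        ≈⟨ *-congʳ (/-*-cancel _ Q₃≉0) ⟩
      (1# - a * b * c) * (1# - a * q ^ 3 / b) * (1# - a * q ^ 3 / c) * (b * c)
        ≈⟨ solve 5 (λ s y z b c → s :* (𝟏 :- y) :* (𝟏 :- z) :* (b :* c) := s :* ((𝟏 :- y) :* b) :* ((𝟏 :- z) :* c))
                 refl (1# - a * b * c) (a * q ^ 3 / b) (a * q ^ 3 / c) b c ⟩
      (1# - a * b * c) * ((1# - a * q ^ 3 / b) * b) * ((1# - a * q ^ 3 / c) * c)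
        ≈⟨ *-cong (*-congˡ (1-/-clear _ b≉0)) (1-/-clear _ c≉0) ⟩
      (1# - a * b * c) * (b - a * q ^ 3) * (c - a * q ^ 3)
        ∎

    p₁ p₂ p₃ p₄ : Carrier
    p₁ = u * ((1# - a * q * u) * (1# - a * q * (u * q)) * f * (b * c))
    p₂ = a * q ^ 3 * Pf * (1# - b * u) * (1# - c * u)
    p₃ = (b - a * q ^ 3) * (c - a * q ^ 3) * Pf * u
    p₄ = a * q ^ 3 * e₁ * e₂ * f

    summand-term : summand a k * Δ ≈ N * p₁
    summand-term = begin
      summand a k * Δ                ≈⟨ *-congˡ Δ≈ ⟩
      summand a k * ((D₂ * A₁) * m)  ≈⟨ *-assoc _ _ _ ⟨
      summand a k * (D₂ * A₁) * m    ≈⟨ *-congʳ (summand-cleared a (nonzero-* D₂≉0 A₁≉0)) ⟩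
      N * u * m                      ≈⟨ *-assoc N u m ⟩
      N * p₁                         ∎
      where
      m : Carrier
      m = (1# - a * q * u) * (1# - a * q * (u * q)) * f * (b * c)
      Δ≈ : Δ ≈ (D₂ * A₁) * m
      Δ≈ = begin
        D₂ * (A₃ * f) * (b * c * Q₂)
          ≈⟨ solve 6 (λ D A f b c Q → D :* (A :* f) :* (b :* c :* Q) := D :* (Q :* A) :* (f :* (b :* c)))
                   refl D₂ A₃ f b c Q₂ ⟩
        D₂ * (Q₂ * A₃) * (f * (b * c))
          ≈⟨ *-congʳ (*-congˡ A₁-A₃) ⟨
        D₂ * (A₁ * (1# - a * q * u) * (1# - a * q * (u * q))) * (f * (b * c))
          ≈⟨ solve 6 (λ D A g h f s → D :* (A :* g :* h) :* (f :* s) := (D :* A) :* (g :* h :* f :* s))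
                   refl D₂ A₁ (1# - a * q * u) (1# - a * q * (u * q)) f (b * c) ⟩
        (D₂ * A₁) * m
          ∎

    next-remainder-term : remainderCoefficient * remainder (suc k) * Δ ≈ N * p₂
    next-remainder-term = begin
      remainderCoefficient * remainder (suc k) * Δ
        ≈⟨ *-congˡ (solve 3 (λ D A S → D :* A :* S := S :* (D :* A)) refl D₂ (A₃ * f) (b * c * Q₂)) ⟩
      remainderCoefficient * remainder (suc k) * ((b * c * Q₂) * (D₂ * (A₃ * f)))
        ≈⟨ *-clear remainderCoefficient-cleared remainder-cleared ⟩
      a * q ^ 3 * (P * Pf * (B * (1# - b * u)) * (C * (1# - c * u)))
        ≈⟨ solve 7 (λ y P Pf B C s t → y :* (P :* Pf :* (B :* s) :* (C :* t)) := P :* B :* C :* (y :* Pf :* s :* t))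
                 refl (a * q ^ 3) P Pf B C (1# - b * u) (1# - c * u) ⟩
      N * p₂
        ∎
      where
      remainder-cleared : remainder (suc k) * (D₂ * (A₃ * f)) ≈ P * Pf * (B * (1# - b * u)) * (C * (1# - c * u))
      remainder-cleared = begin
        remainder (suc k) * (D₂ * (A₃ * f))
          ≡⟨ ≡.cong (λ t → (P * Pf * (B * (1# - b * u)) * (C * (1# - c * u))) / (t * (A₃ * f)) * (D₂ * (A₃ * f)))
                    D₂-index′ ⟩
        P * Pf * (B * (1# - b * u)) * (C * (1# - c * u)) / (D₂ * (A₃ * f)) * (D₂ * (A₃ * f))
          ≈⟨ /-*-cancel _ (nonzero-* D₂≉0 A₃f≉0) ⟩
        P * Pf * (B * (1# - b * u)) * (C * (1# - c * u))
          ∎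

    shifted-summand-term : shiftCoefficient * summand (a * q ^ 3) k * Δ ≈ N * p₃
    shifted-summand-term = begin
      shiftCoefficient * summand (a * q ^ 3) k * Δ
        ≈⟨ *-congˡ Δ≈ ⟩
      shiftCoefficient * summand (a * q ^ 3) k * ((Q₃ * (b * c)) * (D₂ * A₄))
        ≈⟨ *-clear shiftCoefficient-cleared (summand-cleared (a * q ^ 3) (nonzero-* D₂≉0 A₄≉0)) ⟩
      (1# - a * b * c) * (b - a * q ^ 3) * (c - a * q ^ 3) * (P′ * B * C * u)
        ≈⟨ solve 7 (λ s y z P′ B C u → s :* y :* z :* (P′ :* B :* C :* u) := (P′ :* s) :* (y :* z :* B :* C :* u))
                 refl (1# - a * b * c) (b - a * q ^ 3) (c - a * q ^ 3) P′ B C u ⟩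
      (P′ * (1# - a * b * c)) * ((b - a * q ^ 3) * (c - a * q ^ 3) * B * C * u)
        ≈⟨ *-congʳ P′-P ⟩
      (P * Pf) * ((b - a * q ^ 3) * (c - a * q ^ 3) * B * C * u)
        ≈⟨ solve 7 (λ P Pf y z B C u → (P :* Pf) :* (y :* z :* B :* C :* u) := P :* B :* C :* (y :* z :* Pf :* u))
                 refl P Pf (b - a * q ^ 3) (c - a * q ^ 3) B C u ⟩
      N * p₃
        ∎
      where
      Δ≈ : Δ ≈ (Q₃ * (b * c)) * (D₂ * A₄)
      Δ≈ = begin
        D₂ * (A₃ * f) * (b * c * Q₂)
          ≈⟨ *-congʳ (*-congˡ A₄-A₃) ⟨
        D₂ * (A₄ * (1# - a * q ^ 3)) * (b * c * Q₂)
          ≈⟨ solve 6 (λ D A g b c Q → D :* (A :* g) :* (b :* c :* Q) := (Q :* g) :* (b :* c) :* (D :* A))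
                   refl D₂ A₄ (1# - a * q ^ 3) b c Q₂ ⟩
        (Q₂ * (1# - a * q ^ 3)) * (b * c) * (D₂ * A₄)
          ≈⟨ *-assoc _ _ _ ⟩
        (Q₂ * (1# - a * q ^ 3)) * ((b * c) * (D₂ * A₄))
          ≈⟨ *-congʳ Q₂-Q₃ ⟩
        Q₃ * ((b * c) * (D₂ * A₄))
          ≈⟨ *-assoc _ _ _ ⟨
        (Q₃ * (b * c)) * (D₂ * A₄)
          ∎

    remainder-term : remainderCoefficient * remainder k * Δ ≈ N * p₄
    remainder-term = begin
      remainderCoefficient * remainder k * Δ
        ≈⟨ *-congˡ (solve 6 (λ D e₁ e₂ A f S → D :* e₁ :* e₂ :* (A :* f) :* S := (S :* (D :* A)) :* (e₁ :* e₂ :* f))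
                      refl D e₁ e₂ A₃ f (b * c * Q₂)) ⟩
      remainderCoefficient * remainder k * ((b * c * Q₂) * (D * A₃) * (e₁ * e₂ * f))
        ≈⟨ *-assoc _ _ _ ⟨
      remainderCoefficient * remainder k * ((b * c * Q₂) * (D * A₃)) * (e₁ * e₂ * f)
        ≈⟨ *-congʳ (*-clear remainderCoefficient-cleared (/-*-cancel N (nonzero-* D≉0 A₃≉0))) ⟩
      a * q ^ 3 * N * (e₁ * e₂ * f)
        ≈⟨ solve 5 (λ y N e₁ e₂ f → y :* N :* (e₁ :* e₂ :* f) := N :* (y :* e₁ :* e₂ :* f)) refl (a * q ^ 3) N e₁ e₂ f ⟩
      N * p₄
        ∎
      where
      A₃≉0 : ¬ (A₃ ≈ 0#)
      A₃≉0 = nonzero-*ˡ A₃f≉0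

    cleared-step-identity : p₁ + p₂ ≈ p₃ + p₄
    cleared-step-identity = *-cancelʳ-nonzero (nonzero-* q²≉0 q²≉0) (begin
      (p₁ + p₂) * (q ^ 2 * q ^ 2)
        ≈⟨ *-congʳ (+-congˡ (*-congʳ (*-congʳ (*-congˡ Pf-cube)))) ⟩
      (p₁ + a * q ^ 3 * (1# - a * b * c * (u * u * u)) * (1# - b * u) * (1# - c * u)) * (q ^ 2 * q ^ 2)
        ≈⟨ step-polynomial-identity u ⟩
      (b - a * q ^ 3) * (c - a * q ^ 3) * (1# - a * b * c * (u * u * u)) * u * (q ^ 2 * q ^ 2)
        + a * q ^ 3 * (q ^ 2 - b * c * (u * u)) * (q ^ 2 - b * c * (u * u * q)) * f
        ≈⟨ +-cong (*-congʳ (*-congʳ (*-congˡ Pf-cube))) (*-congʳ (*-cong (*-congˡ q²e₁) q²e₂)) ⟨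
      p₃ * (q ^ 2 * q ^ 2) + a * q ^ 3 * (q ^ 2 * e₁) * (q ^ 2 * e₂) * f
        ≈⟨ solve 6 (λ p y s e₁ e₂ f → p :* (s :* s) :+ y :* (s :* e₁) :* (s :* e₂) :* f := (p :+ y :* e₁ :* e₂ :* f) :* (s :* s))
                 refl p₃ (a * q ^ 3) (q ^ 2) e₁ e₂ f ⟩
      (p₃ + p₄) * (q ^ 2 * q ^ 2)
        ∎)
      where
      q²≉0 : ¬ (q ^ 2 ≈ 0#)
      q²≉0 = ^-nonzero q≉0 2

    summand-step : summand a k + remainderCoefficient * remainder (suc k)
                   ≈ shiftCoefficient * summand (a * q ^ 3) k + remainderCoefficient * remainder k
    summand-step = *-cancelʳ-nonzero Δ≉0 (begin
      (summand a k + remainderCoefficient * remainder (suc k)) * Δ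
        ≈⟨ distribʳ Δ _ _ ⟩
      summand a k * Δ + remainderCoefficient * remainder (suc k) * Δ
        ≈⟨ +-cong summand-term next-remainder-term ⟩
      N * p₁ + N * p₂
        ≈⟨ distribˡ N p₁ p₂ ⟨
      N * (p₁ + p₂)
        ≈⟨ *-congˡ cleared-step-identity ⟩
      N * (p₃ + p₄)
        ≈⟨ distribˡ N p₃ p₄ ⟩
      N * p₃ + N * p₄
        ≈⟨ +-cong shifted-summand-term remainder-term ⟨
      shiftCoefficient * summand (a * q ^ 3) k * Δ + remainderCoefficient * remainder k * Δ
        ≈⟨ distribʳ Δ _ _ ⟨
      (shiftCoefficient * summand (a * q ^ 3) k + remainderCoefficient * remainder k) * Δ
        ∎)

  remainder-zero : remainder 0 ≈ 1#
  remainder-zero = trans (*-congʳ (*-identityʳ (1# * 1#))) (inverseʳ _ (nonzero-* 1≉0 1≉0))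

  χ-recurrence : ¬ (q ≈ 0#) → ¬ (b ≈ 0#) → ¬ (c ≈ 0#) →
    ¬ (poch (a * q) q 2 ≈ 0#) → ¬ (poch (a * q) q 3 ≈ 0#) → ∀ n →
    (∀ k → k < n → ¬ (poch x q (2 *ℕ k +ℕ 2) ≈ 0#)) →
    (∀ k → k < n → ¬ (poch (a * q) q k ≈ 0#)) →
    (∀ k → k < n → ¬ (poch (a * q ^ 3 * q) q k ≈ 0#)) →
    χ q n a b c ≈ shiftCoefficient * χ q n (a * q ^ 3) b c + remainderCoefficient * (1# - remainder n)
  χ-recurrence q≉0 b≉0 c≉0 Q₂≉0 Q₃≉0 n D≉0 A₁≉0 A₄≉0 = begin
    X
      ≈⟨ solve 3 (λ X C U → X := (X :+ C :* U) :- C :* U) refl X C (remainder n) ⟩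
    (X + C * remainder n) - C * remainder n
      ≈⟨ +-congʳ (telescope n shiftCoefficient (summand a) (summand (a * q ^ 3)) (λ k → C * remainder k)
                   λ k k<n → Step.summand-step q≉0 b≉0 c≉0 Q₂≉0 Q₃≉0 k (D≉0 k k<n) (A₁≉0 k k<n) (A₄≉0 k k<n)) ⟩
    (Y + C * remainder 0) - C * remainder n
      ≈⟨ +-congʳ (+-congˡ (*-congˡ remainder-zero)) ⟩
    (Y + C * 1#) - C * remainder n
      ≈⟨ solve 3 (λ Y C U → (Y :+ C :* 𝟏) :- C :* U := Y :+ C :* (𝟏 :- U)) refl Y C (remainder n) ⟩
    Y + C * (1# - remainder n)
      ∎
    where
    X Y C : Carrier
    X = χ q n a b c
    Y = shiftCoefficient * χ q n (a * q ^ 3) b c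
    C = remainderCoefficient

theorem3p4 : {c ℓ : Level} (F : Field c ℓ) →
    let open Field F
        open FieldDefs F
    in (q a b c : Carrier) (n : ℕ) →
       ¬ (q ≈ 0#) → ¬ (b ≈ 0#) → ¬ (c ≈ 0#) →
       (∀ k → k < n → ¬ (poch (b * c / q ^ 2) q (2 *ℕ k +ℕ 2) ≈ 0#)) →
       (∀ k → k < n → ¬ (poch (a * q) q k ≈ 0#)) →
       (∀ k → k < n → ¬ (poch (a * q ^ 3 * q) q k ≈ 0#)) →
       ¬ (poch (a * q) q 3 ≈ 0#) →
       ¬ (poch (a * q) q 2 ≈ 0#) →
       ¬ (poch (b * c / q ^ 2) q (2 *ℕ n) ≈ 0#) →
       ¬ (poch (a * q ^ 3) q n ≈ 0#) →
       χ q n a b c ≈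
         ((1# - a * b * c) * (1# - a * q ^ 3 / b) * (1# - a * q ^ 3 / c)
            / poch (a * q) q 3) * χ q n (a * q ^ 3) b c
         + (a * q ^ 3 / (b * c * poch (a * q) q 2))
           * (1# - (poch (a * b * c) (q ^ 3) n * poch b q n * poch c q n)
                   / (poch (b * c / q ^ 2) q (2 *ℕ n) * poch (a * q ^ 3) q n))
theorem3p4 F q a b c n q≉0 b≉0 c≉0 D≉0 A₁≉0 A₄≉0 Q₃≉0 Q₂≉0 _ _ =
  Recurrence.χ-recurrence F q a b c q≉0 b≉0 c≉0 Q₂≉0 Q₃≉0 n D≉0 A₁≉0 A₄≉0
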